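{- Let $n\ge1$ and let $B_n^-=\{\sigma\in B_n:\sigma(i)<0\text{ for all }i\in[n]\}$. Then $$\sum_{\sigma\in B_n^- }(-1)^{\mathrm{cyc}(\sigma)}s^{\mathrm{neg}(\sigma)}t^{\mathrm{nsum}(\sigma)}\prod_{i\in\mathrm{EXC_B}(\sigma)}x_i=(-1)^ns^nt^{n(n+1)/2}x_n\prod_{j=1}^{n-1}(x_j-1).$$
   Context: $B_n$ is the set of permutations $\sigma$ of $\{\pm1,\dots,\pm n\}$ with $\sigma(-i)=-\sigma(i)$ for all $i\in[n]$, identified with the word $\sigma(1)\cdots\sigma(n)$; $|\sigma|$ denotes the permutation $i\mapsto|\sigma(i)|$ of $[n]$, and $\mathrm{cyc}(\sigma)$ is the number of cycles of $|\sigma|$. $\mathrm{Neg}(\sigma)=\{i\in[n]:\sigma(i)<0\}$, $\mathrm{neg}(\sigma)=\#\mathrm{Neg}(\sigma)$, $\mathrm{nsum}(\sigma)=\sum_{i\in\mathrm{Neg}(\sigma)}|\sigma(i)|$. The set of type B excedances is $\mathrm{EXC_B}(\sigma)=\{|\sigma(i)|:i\in[n],\ \sigma(|\sigma(i)|)=-|\sigma(i)|\text{ or }\sigma(|\sigma(i)|)>\sigma(i)\}$. $x_1,\dots,x_n,s,t$ are commuting indeterminates. -}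

module Defs where

open import Level using (Level)
open import Data.Bool using (Bool; true; false; if_then_else_; _∧_; _∨_; not)
open import Data.Nat using (ℕ; zero; suc; _≤ᵇ_) renaming (_+_ to _+ℕ_)
open import Data.Fin using (Fin; toℕ)
open import Data.Fin.Properties using () renaming (_≟_ to _≟ᶠ_)
open import Data.Integer using (ℤ; +_; -[1+_]) renaming (_<?_ to _<ℤ?_)
open import Data.Product using (_×_; _,_; proj₁; proj₂)
open import Data.List using (List; []; _∷_; map; concatMap; filter; foldr; allFin; upTo; cartesianProduct; length)
open import Data.Bool.ListAction using (all; any)
open import Data.Vec using (Vec; lookup) renaming ([] to []ᵥ; _∷_ to _∷ᵥ_)
open import Relation.Nullary.Decidable using (⌊_⌋)
open import Algebra.Bundles using (CommutativeRing)

-- A letter (b , k) : Bool × Fin n denotes the integer  -(k+1) if b = true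
-- and  +(k+1) if b = false.  Positions i : Fin n stand for i+1 ∈ [n].
-- An element σ ∈ B_n is identified with its word σ(1)⋯σ(n), a vector of
-- n letters whose absolute values are pairwise distinct (σ(-i) = -σ(i)
-- is then automatic).

Letter : ℕ → Set
Letter n = Bool × Fin n

Word : ℕ → Set
Word n = Vec (Letter n) n

val : ∀ {n} → Letter n → ℤ
val (true  , k) = -[1+ toℕ k ]
val (false , k) = + suc (toℕ k)

isNeg : ∀ {n} → Letter n → Bool
isNeg (b , _) = b

absL : ∀ {n} → Letter n → Fin n
absL (_ , k) = k

allVecs : ∀ {A : Set} (m : ℕ) → List A → List (Vec A m)
allVecs zero    xs = []ᵥ ∷ []
allVecs (suc m) xs = concatMap (λ a → map (a ∷ᵥ_) (allVecs m xs)) xs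

allLetters : (n : ℕ) → List (Letter n)
allLetters n = cartesianProduct (true ∷ false ∷ []) (allFin n)

isSignedPerm : ∀ {n} → Word n → Bool
isSignedPerm {n} w =
  all (λ i → all (λ j → not ⌊ absL (lookup w i) ≟ᶠ absL (lookup w j) ⌋ ∨ ⌊ i ≟ᶠ j ⌋)
                 (allFin n))
      (allFin n)

B : (n : ℕ) → List (Word n)
B n = filter (λ w → isSignedPerm w Data.Bool.≟ true) (allVecs n (allLetters n))

allNeg : ∀ {n} → Word n → Bool
allNeg {n} w = all (λ i → isNeg (lookup w i)) (allFin n)

Bminus : (n : ℕ) → List (Word n)
Bminus n = filter (λ w → allNeg w Data.Bool.≟ true) (B n)

absPerm : ∀ {n} → Word n → Fin n → Fin n
absPerm w i = absL (lookup w i)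

iter : ∀ {A : Set} → ℕ → (A → A) → A → A
iter zero    f a = a
iter (suc k) f a = f (iter k f a)

-- the cycle of |σ| through i : { |σ|^k(i) : 0 ≤ k < n } (orbits have size ≤ n)
orbit : ∀ {n} → Word n → Fin n → List (Fin n)
orbit {n} w i = map (λ k → iter k (absPerm w) i) (upTo n)

isCycleMin : ∀ {n} → Word n → Fin n → Bool
isCycleMin w i = all (λ j → toℕ i ≤ᵇ toℕ j) (orbit w i)

cyc : ∀ {n} → Word n → ℕ
cyc {n} w = length (filter (λ i → isCycleMin w i Data.Bool.≟ true) (allFin n))

Neg : ∀ {n} → Word n → List (Fin n)
Neg {n} w = filter (λ i → isNeg (lookup w i) Data.Bool.≟ true) (allFin n)

neg : ∀ {n} → Word n → ℕ
neg w = length (Neg w)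

nsum : ∀ {n} → Word n → ℕ
nsum w = foldr (λ i acc → suc (toℕ (absL (lookup w i))) +ℕ acc) 0 (Neg w)

-- j ∈ EXC_B(σ)  iff  ∃ i. |σ(i)| = j and (σ(j) = -j or σ(j) > σ(i))
-- (here j is a value in [n], used also as a position)
inEXC : ∀ {n} → Word n → Fin n → Bool
inEXC {n} w j =
  any (λ i → ⌊ absL (lookup w i) ≟ᶠ j ⌋
             ∧ ((isNeg (lookup w j) ∧ ⌊ absL (lookup w j) ≟ᶠ j ⌋)
                ∨ ⌊ val (lookup w i) <ℤ? val (lookup w j) ⌋))
      (allFin n)

-- Ring-valued sums/products (polynomial identities are stated in an
-- arbitrary commutative ring at arbitrary values of the indeterminates).

module RingOps {c ℓ : Level} (R : CommutativeRing c ℓ) where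
  open CommutativeRing R

  pow : Carrier → ℕ → Carrier
  pow a zero    = 1#
  pow a (suc k) = a * pow a k

  sumL : ∀ {A : Set} → List A → (A → Carrier) → Carrier
  sumL xs f = foldr (λ a acc → f a + acc) 0# xs

  prodFin : (m : ℕ) → (Fin m → Carrier) → Carrier
  prodFin m f = foldr (λ i acc → f i * acc) 1# (allFin m)

  excWeight : ∀ {n} → (Fin n → Carrier) → Word n → Carrier
  excWeight {n} x w = prodFin n (λ j → if inEXC w j then x j else 1#)

{-# OPTIONS --safe #-}
-- A word σ ∈ B_n^- is -q(1)⋯-q(n) for the permutation q = |σ|, so
-- neg σ = n, nsum σ = 1 + ⋯ + n, and j ∈ EXC_B(σ) iff q(j) ≤ j. What is
-- left is Σ_q (-1)^cyc(q) ∏_j (x_j if q(j) ≤ j, else y_j) with y = 1, and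
-- for arbitrary y this equals (-1)^n x_n ∏_{j<n} (x_j - y_j), by induction
-- on n. Every permutation of [n+1] arises exactly once from one of [n] by
-- adding n+1 as a fixed point (one more cycle: a factor -x_{n+1}) or by
-- inserting it into a cycle after some a (same cycles; a loses q(a) ≤ a and
-- contributes y_a). In the second case the inner closed form, taken with
-- x_a = y_a = 1, vanishes unless a = n, as it then contains the factor 1 - 1.
module Submission where

open import Defs
open import Level using (Level)
open import Function using (_∘_; id; _⇔_; mk⇔; Injective; Equivalence)
open import Data.Empty using (⊥-elim)
open import Data.Unit using (tt)
open import Data.Product using (∃; _×_; _,_; proj₂)
open import Data.Sum using (_⊎_; inj₁; inj₂)
open import Data.Bool using (Bool; true; false; T; if_then_else_; not; _∧_; _∨_)
import Data.Bool as Bool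
open import Data.Bool.Properties using (T-≡; T-∧; T-∨; if-cong; if-cong₂; if-eta)
open import Data.Bool.ListAction using (all)
open import Data.Nat using (ℕ; zero; suc; _≤_; _<_; _≤ᵇ_; s≤s⁻¹) renaming (_*_ to _*ℕ_; _+_ to _+ℕ_)
import Data.Nat.Properties as ℕ
open import Data.Nat.DivMod using (_/_; _%_; m%n<n; m≡m%n+[m/n]*n; m*n/n≡m)
open import Data.Nat.ListAction using (sum)
open import Data.Nat.ListAction.Properties using (sum-↭)
open import Data.Nat.Solver using (module +-*-Solver)
import Data.Integer as ℤ
open import Data.Integer using (-[1+_]) renaming (_<?_ to _<ℤ?_)
open import Data.Fin using (Fin; zero; suc; toℕ; fromℕ; inject₁; punchOut; _≟_)
open import Data.Fin.Properties
  using (fromℕ≢inject₁; ≤fromℕ; toℕ-injective; pigeonhole; toℕ<n; inject₁-injective; toℕ-inject₁; toℕ-fromℕ;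
         any?; punchOut-injective; injective⇒≤)
open import Data.Fin.Relation.Unary.Top using (view; ‵fromℕ; ‵inj₁)
open import Data.Vec using (Vec) renaming ([] to []ᵥ; _∷_ to _∷ᵥ_)
import Data.Vec as Vec
import Data.Vec.Properties as Vecₚ
import Data.Vec.Functional as Vector
open import Data.Vec.Functional using (updateAt; init)
open import Data.Vec.Functional.Properties using (updateAt-updates; updateAt-minimal)
open import Data.List
  using (List; []; _∷_; _++_; map; foldr; concatMap; allFin; upTo; filter; length; tabulate; cartesianProductWith)
open import Data.List.Properties
  using (map-cong; map-∘; map-concatMap; map-tabulate; length-tabulate; foldr-map; filter-all)
open import Data.List.Membership.Propositional using (_∈_; find; lose)
open import Data.List.Membership.Propositional.Properties
  using (∈-concatMap⁺; ∈-concatMap⁻; ∈-map⁺; ∈-map⁻; ∈-allFin; ∈-upTo⁺; ∈-cartesianProductWith⁺; ∈-cartesianProduct⁺;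
         ∈-filter⁺; ∈-filter⁻)
open import Data.List.Membership.Propositional.Properties.WithK using (unique∧set⇒bag)
open import Data.List.Relation.Unary.Any as Any using (Any; here; there)
open import Data.List.Relation.Unary.Any.Properties using (any⁺; any⁻)
import Data.List.Relation.Unary.All as All
open import Data.List.Relation.Unary.All using ([]; _∷_)
open import Data.List.Relation.Unary.All.Properties using (all⁺; all⁻)
open import Data.List.Relation.Unary.AllPairs using ([]; _∷_)
open import Data.List.Relation.Unary.Unique.Propositional using (Unique)
open import Data.List.Relation.Unary.Unique.Propositional.Properties
  using (++⁺; map⁺; cartesianProductWith⁺; cartesianProduct⁺; allFin⁺; filter⁺)
open import Data.List.Relation.Binary.BagAndSetEquality using (∼bag⇒↭)
open import Data.List.Relation.Binary.Permutation.Propositional using (_↭_; ↭⇒↭ₛ′)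
import Data.List.Relation.Binary.Permutation.Propositional.Properties as ↭
import Data.List.Relation.Binary.Permutation.Setoid.Properties as SetoidPermutation
open import Algebra.Bundles using (CommutativeRing)
import Algebra.Properties.Ring as RingProperties
import Algebra.Properties.AbelianGroup as AbelianGroupProperties
import Algebra.Properties.CommutativeSemigroup as CommutativeSemigroupProperties
import Algebra.Properties.Monoid.Sum ℕ.+-0-monoid as ℕΣ
import Algebra.Properties.Semiring.Sum as SemiringSum
import Algebra.Properties.CommutativeMonoid.Sum as CommutativeMonoidSum
import Algebra.Solver.CommutativeMonoid as CommutativeMonoidSolver
open import Relation.Nullary using (¬_; Dec; yes; no; contradiction)
open import Relation.Nullary.Decidable using (⌊_⌋; toWitness; fromWitness)
open import Relation.Binary.PropositionalEquality
  using (_≡_; _≢_; _≗_; refl; sym; trans; cong; cong₂; subst; subst₂; module ≡-Reasoning)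
import Relation.Binary.Reasoning.Setoid as SetoidReasoning

private
  variable
    ℓ : Level
    A : Set ℓ
    X Y Z : Set
    m n : ℕ

T-ext : {x y : Bool} → (T x → T y) → (T y → T x) → x ≡ y
T-ext {false} {false} _ _ = refl
T-ext {false} {true}  _ g = ⊥-elim (g tt)
T-ext {true}  {false} f _ = ⊥-elim (f tt)
T-ext {true}  {true}  _ _ = refl

concatMap-map≡cartesianProductWith : (f : X → Y → Z) (xs : List X) (ys : List Y) →
                                     concatMap (λ x → map (f x) ys) xs ≡ cartesianProductWith f xs ys
concatMap-map≡cartesianProductWith f []       ys = refl
concatMap-map≡cartesianProductWith f (x ∷ xs) ys =
  cong (map (f x) ys ++_) (concatMap-map≡cartesianProductWith f xs ys)

unique∧⇔⇒↭ : {xs ys : List X} → Unique xs → Unique ys → (∀ {z} → z ∈ xs ⇔ z ∈ ys) → xs ↭ ys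
unique∧⇔⇒↭ xs! ys! xs⇔ys = ∼bag⇒↭ (unique∧set⇒bag xs! ys! xs⇔ys)

Unique-concatMap : (f : X → List Y) (h : X → Z) (decode : Y → Z) {xs : List X} →
                   Unique (map h xs) → (∀ a → Unique (f a)) →
                   (∀ a {b} → b ∈ f a → decode b ≡ h a) → Unique (concatMap f xs)
Unique-concatMap f h decode {[]}     _           _    _        = []
Unique-concatMap f h decode {a ∷ xs} (ha∉ ∷ hxs!) fa! decodes =
  ++⁺ (fa! a) (Unique-concatMap f h decode hxs! fa! decodes) disjoint
  where
  disjoint : ∀ {b} → ¬ (b ∈ f a × b ∈ concatMap f xs)
  disjoint (b∈fa , b∈rest) with find (∈-concatMap⁻ f {xs = xs} b∈rest)
  ... | a′ , a′∈xs , b∈fa′ =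
    All.lookup ha∉ (∈-map⁺ h a′∈xs) (trans (sym (decodes a b∈fa)) (decodes a′ b∈fa′))

foldr-tabulate : (g : A → A → A) (e : A) (f : Fin n → A) (h : Fin m → Fin n) →
                 foldr (λ i → g (f i)) e (tabulate h) ≡ Vector.foldr g e (f ∘ h)
foldr-tabulate {m = zero}  g e f h = refl
foldr-tabulate {m = suc m} g e f h = cong (g (f (h zero))) (foldr-tabulate g e f (h ∘ suc))

foldr-allFin : (g : A → A → A) (e : A) (f : Fin n → A) →
               foldr (λ i → g (f i)) e (allFin n) ≡ Vector.foldr g e f
foldr-allFin g e f = foldr-tabulate g e f id

injective⇒surjective : {q : Fin n → Fin n} → Injective _≡_ _≡_ q → ∀ j → ∃ λ i → q i ≡ j
injective⇒surjective {suc n} {q} q-inj j with any? (λ i → q i ≟ j)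
... | yes hit = hit
... | no  miss = contradiction (injective⇒≤ squeeze-injective) ℕ.1+n≰n
  where
  j≢q : ∀ i → j ≢ q i
  j≢q i j≡qi = miss (i , sym j≡qi)
  squeeze : Fin (suc n) → Fin n
  squeeze i = punchOut (j≢q i)
  squeeze-injective : Injective _≡_ _≡_ squeeze
  squeeze-injective = q-inj ∘ punchOut-injective (j≢q _) (j≢q _)

snoc : (Fin m → X) → X → Fin (suc m) → X
snoc {zero}  f z zero    = z
snoc {suc m} f z zero    = f zero
snoc {suc m} f z (suc i) = snoc (f ∘ suc) z i

snoc-inject₁ : (f : Fin m → X) (z : X) (j : Fin m) → snoc f z (inject₁ j) ≡ f j
snoc-inject₁ f z zero    = refl
snoc-inject₁ f z (suc j) = snoc-inject₁ (f ∘ suc) z j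

snoc-fromℕ : (f : Fin m → X) (z : X) → snoc f z (fromℕ m) ≡ z
snoc-fromℕ {zero}  f z = refl
snoc-fromℕ {suc m} f z = snoc-fromℕ (f ∘ suc) z

snoc-unique : {g : Fin (suc m) → X} (f : Fin m → X) (z : X) →
              (∀ j → g (inject₁ j) ≡ f j) → g (fromℕ m) ≡ z → g ≗ snoc f z
snoc-unique f z g∘inject₁ g-fromℕ i with view i
... | ‵fromℕ          = trans g-fromℕ (sym (snoc-fromℕ f z))
... | ‵inj₁ {i = j} _ = trans (g∘inject₁ j) (sym (snoc-inject₁ f z j))

inject₁-snoc-id : (d : Fin m) {i : Fin (suc m)} → i ≢ fromℕ m → inject₁ (snoc id d i) ≡ i
inject₁-snoc-id d {i} i≢fromℕ with view i
... | ‵fromℕ          = contradiction refl i≢fromℕ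
... | ‵inj₁ {i = j} _ = cong inject₁ (snoc-inject₁ id d j)

snoc-injective : {f : Fin m → X} {z : X} → Injective _≡_ _≡_ f → (∀ j → f j ≢ z) →
                 Injective _≡_ _≡_ (snoc f z)
snoc-injective {f = f} {z} f-inj f≢z {i} {j} eq with view i | view j
... | ‵fromℕ | ‵fromℕ = refl
... | ‵fromℕ | ‵inj₁ {i = j′} _ =
  contradiction (trans (sym (snoc-inject₁ f z j′)) (trans (sym eq) (snoc-fromℕ f z))) (f≢z j′)
... | ‵inj₁ {i = i′} _ | ‵fromℕ =
  contradiction (trans (sym (snoc-inject₁ f z i′)) (trans eq (snoc-fromℕ f z))) (f≢z i′)
... | ‵inj₁ {i = i′} _ | ‵inj₁ {i = j′} _ =
  cong inject₁ (f-inj (trans (sym (snoc-inject₁ f z i′)) (trans eq (snoc-inject₁ f z j′))))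

-- Permutations of Fin (suc m) as extensions of permutations of Fin m

fixLast : (Fin m → Fin m) → Fin (suc m) → Fin (suc m)
fixLast {m} p = snoc (inject₁ ∘ p) (fromℕ m)

-- p with the new largest element fromℕ m inserted into its cycle right after a.
insertLast : (Fin m → Fin m) → Fin m → Fin (suc m) → Fin (suc m)
insertLast {m} p a = snoc (updateAt (inject₁ ∘ p) a (λ _ → fromℕ m)) (inject₁ (p a))

module _ (p : Fin m → Fin m) where

  fixLast-inject₁ : ∀ j → fixLast p (inject₁ j) ≡ inject₁ (p j)
  fixLast-inject₁ = snoc-inject₁ _ _

  fixLast-fromℕ : fixLast p (fromℕ m) ≡ fromℕ m
  fixLast-fromℕ = snoc-fromℕ (inject₁ ∘ p) _

  module _ (a : Fin m) where

    insertLast-inject₁-at : insertLast p a (inject₁ a) ≡ fromℕ m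
    insertLast-inject₁-at = trans (snoc-inject₁ _ _ a) (updateAt-updates a (inject₁ ∘ p))

    insertLast-inject₁ : ∀ {j} → j ≢ a → insertLast p a (inject₁ j) ≡ inject₁ (p j)
    insertLast-inject₁ {j} j≢a = trans (snoc-inject₁ _ _ j) (updateAt-minimal j a (inject₁ ∘ p) j≢a)

    insertLast-fromℕ : insertLast p a (fromℕ m) ≡ inject₁ (p a)
    insertLast-fromℕ = snoc-fromℕ (updateAt (inject₁ ∘ p) a (λ _ → fromℕ m)) _

  module _ (p-inj : Injective _≡_ _≡_ p) where

    fixLast-injective : Injective _≡_ _≡_ (fixLast p)
    fixLast-injective = snoc-injective (p-inj ∘ inject₁-injective) (λ j → fromℕ≢inject₁ ∘ sym)

    insertLast-injective : ∀ a → Injective _≡_ _≡_ (insertLast p a)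
    insertLast-injective a = snoc-injective body-injective body≢
      where
      body : Fin m → Fin (suc m)
      body = updateAt (inject₁ ∘ p) a (λ _ → fromℕ m)
      body-at : body a ≡ fromℕ m
      body-at = updateAt-updates a (inject₁ ∘ p)
      body-off : ∀ {j} → j ≢ a → body j ≡ inject₁ (p j)
      body-off j≢a = updateAt-minimal _ a (inject₁ ∘ p) j≢a
      body≢ : ∀ j → body j ≢ inject₁ (p a)
      body≢ j with j ≟ a
      ... | yes refl = fromℕ≢inject₁ ∘ trans (sym body-at)
      ... | no  j≢a  = j≢a ∘ p-inj ∘ inject₁-injective ∘ trans (sym (body-off j≢a))
      body-injective : Injective _≡_ _≡_ body
      body-injective {i} {j} eq with i ≟ a | j ≟ a
      ... | yes i≡a | yes j≡a = trans i≡a (sym j≡a)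
      ... | yes refl | no j≢a = contradiction (trans (sym body-at) (trans eq (body-off j≢a))) fromℕ≢inject₁
      ... | no i≢a | yes refl = contradiction (trans (sym body-at) (trans (sym eq) (body-off i≢a))) fromℕ≢inject₁
      ... | no i≢a | no j≢a = p-inj (inject₁-injective (trans (sym (body-off i≢a)) (trans eq (body-off j≢a))))

extensions : (Fin m → Fin m) → List (Fin (suc m) → Fin (suc m))
extensions {m} p = fixLast p ∷ map (insertLast p) (allFin m)

perms : (n : ℕ) → List (Fin n → Fin n)
perms zero    = (λ ()) ∷ []
perms (suc m) = concatMap extensions (perms m)

data Extension (p : Fin m → Fin m) : (Fin (suc m) → Fin (suc m)) → Set where
  fixed    : Extension p (fixLast p)
  inserted : ∀ a → Extension p (insertLast p a)

extension-injective : {p : Fin m → Fin m} {π : Fin (suc m) → Fin (suc m)} →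
                      Injective _≡_ _≡_ p → Extension p π → Injective _≡_ _≡_ π
extension-injective p-inj fixed        = fixLast-injective _ p-inj
extension-injective p-inj (inserted a) = insertLast-injective _ p-inj a

∈-perms⁺ : {p : Fin m → Fin m} {π : Fin (suc m) → Fin (suc m)} →
           p ∈ perms m → Extension p π → π ∈ perms (suc m)
∈-perms⁺ {m} {p} p∈ e = ∈-concatMap⁺ extensions (Any.map (λ { refl → ∈-extensions e }) p∈)
  where
  ∈-extensions : ∀ {π} → Extension p π → π ∈ extensions p
  ∈-extensions fixed        = here refl
  ∈-extensions (inserted a) = there (∈-map⁺ (insertLast p) (∈-allFin a))

∈-extensions⁻ : {p : Fin m → Fin m} {π : Fin (suc m) → Fin (suc m)} → π ∈ extensions p → Extension p π
∈-extensions⁻ (here refl) = fixed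
∈-extensions⁻ {p = p} (there π∈) with ∈-map⁻ (insertLast p) π∈
... | a , _ , refl = inserted a

∈-perms⁻ : {π : Fin (suc m) → Fin (suc m)} → π ∈ perms (suc m) →
           ∃ λ p → p ∈ perms m × Extension p π
∈-perms⁻ {m} π∈ with find (∈-concatMap⁻ extensions {xs = perms m} π∈)
... | p , p∈ , π∈ext = p , p∈ , ∈-extensions⁻ π∈ext

perms-injective : {q : Fin n → Fin n} → q ∈ perms n → Injective _≡_ _≡_ q
perms-injective {zero}  _ {()}
perms-injective {suc m} q∈ with ∈-perms⁻ q∈
... | p , p∈ , e = extension-injective (perms-injective p∈) e

-- The successor of inject₁ y under π once fromℕ m is deleted from its cycle,
-- and the permutation of Fin m so obtained (y is a junk value that is never
-- used when π is injective).
skipLast : (Fin (suc m) → Fin (suc m)) → Fin m → Fin (suc m)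
skipLast {m} π y = if ⌊ π (inject₁ y) ≟ fromℕ m ⌋ then π (fromℕ m) else π (inject₁ y)

restrict : (Fin (suc m) → Fin (suc m)) → Fin m → Fin m
restrict π y = snoc id y (skipLast π y)

restrict-cong : {π π′ : Fin (suc m) → Fin (suc m)} → π ≗ π′ → restrict π ≗ restrict π′
restrict-cong {m} π≗π′ y rewrite π≗π′ (inject₁ y) | π≗π′ (fromℕ m) = refl

module _ (π : Fin (suc m) → Fin (suc m)) {y : Fin m} where

  skipLast-at : π (inject₁ y) ≡ fromℕ m → skipLast π y ≡ π (fromℕ m)
  skipLast-at eq with π (inject₁ y) ≟ fromℕ m
  ... | yes _  = refl
  ... | no neq = contradiction eq neq

  skipLast-off : π (inject₁ y) ≢ fromℕ m → skipLast π y ≡ π (inject₁ y)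
  skipLast-off neq with π (inject₁ y) ≟ fromℕ m
  ... | yes eq = contradiction eq neq
  ... | no _   = refl

skipLast-extension : {p : Fin m → Fin m} {π : Fin (suc m) → Fin (suc m)} →
                     Extension p π → ∀ y → skipLast π y ≡ inject₁ (p y)
skipLast-extension {p = p} fixed y =
  trans (skipLast-off (fixLast p) (fromℕ≢inject₁ ∘ sym ∘ trans (sym (fixLast-inject₁ p y)))) (fixLast-inject₁ p y)
skipLast-extension {p = p} (inserted a) y with y ≟ a
... | yes refl = trans (skipLast-at (insertLast p y) (insertLast-inject₁-at p y)) (insertLast-fromℕ p y)
... | no y≢a   = trans (skipLast-off (insertLast p a) (fromℕ≢inject₁ ∘ sym ∘ trans (sym (insertLast-inject₁ p a y≢a))))
                       (insertLast-inject₁ p a y≢a)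

restrict-extension : {p : Fin m → Fin m} {π : Fin (suc m) → Fin (suc m)} →
                     Extension p π → restrict π ≗ p
restrict-extension e y = trans (cong (snoc id y) (skipLast-extension e y)) (snoc-inject₁ id y _)

module _ {π : Fin (suc m) → Fin (suc m)} (π-inj : Injective _≡_ _≡_ π) where

  skipLast≢fromℕ : ∀ y → skipLast π y ≢ fromℕ m
  skipLast≢fromℕ y with π (inject₁ y) ≟ fromℕ m
  ... | yes eq = λ eq′ → fromℕ≢inject₁ (π-inj (trans eq′ (sym eq)))
  ... | no neq = neq

  inject₁-restrict : ∀ y → inject₁ (restrict π y) ≡ skipLast π y
  inject₁-restrict y = inject₁-snoc-id y (skipLast≢fromℕ y)

  restrict-injective : Injective _≡_ _≡_ (restrict π)
  restrict-injective {y} {y′} eq = skipLast-injective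
    (trans (sym (inject₁-restrict y)) (trans (cong inject₁ eq) (inject₁-restrict y′)))
    where
    skipLast-injective : ∀ {y y′} → skipLast π y ≡ skipLast π y′ → y ≡ y′
    skipLast-injective {y} {y′} eq with π (inject₁ y) ≟ fromℕ m | π (inject₁ y′) ≟ fromℕ m
    ... | yes at  | yes at′ = inject₁-injective (π-inj (trans at (sym at′)))
    ... | yes _   | no _    = contradiction (π-inj eq) fromℕ≢inject₁
    ... | no _    | yes _   = contradiction (π-inj (sym eq)) fromℕ≢inject₁
    ... | no _    | no _    = inject₁-injective (π-inj eq)

  module _ {p : Fin m → Fin m} (p≈ : ∀ y → inject₁ (p y) ≡ skipLast π y) where

    ≗fixLast : π (fromℕ m) ≡ fromℕ m → π ≗ fixLast p
    ≗fixLast fixes = snoc-unique _ _ agree fixes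
      where
      agree : ∀ y → π (inject₁ y) ≡ inject₁ (p y)
      agree y = sym (trans (p≈ y) (skipLast-off π (fromℕ≢inject₁ ∘ π-inj ∘ trans fixes ∘ sym)))

    ≗insertLast : ∀ {a} → π (inject₁ a) ≡ fromℕ m → π ≗ insertLast p a
    ≗insertLast {a} hits = snoc-unique _ _ agree (sym (trans (p≈ a) (skipLast-at π hits)))
      where
      agree : ∀ y → π (inject₁ y) ≡ updateAt (inject₁ ∘ p) a (λ _ → fromℕ m) y
      agree y with y ≟ a
      ... | yes refl = trans hits (sym (updateAt-updates y (inject₁ ∘ p)))
      ... | no y≢a   = trans (sym (trans (p≈ y) (skipLast-off π misses)))
                             (sym (updateAt-minimal y a (inject₁ ∘ p) y≢a))
        where
        misses : π (inject₁ y) ≢ fromℕ m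
        misses eq = y≢a (inject₁-injective (π-inj (trans eq (sym hits))))

perms-complete : {q : Fin n → Fin n} → Injective _≡_ _≡_ q → ∃ λ p → p ∈ perms n × q ≗ p
perms-complete {zero} _ = (λ ()) , here refl , λ ()
perms-complete {suc m} {q} q-inj with perms-complete (restrict-injective q-inj)
... | p , p∈ , restrict≗p = extend (q (fromℕ m) ≟ fromℕ m)
  where
  p≈ : ∀ y → inject₁ (p y) ≡ skipLast q y
  p≈ y = trans (cong inject₁ (sym (restrict≗p y))) (inject₁-restrict q-inj y)
  extend : Dec (q (fromℕ m) ≡ fromℕ m) → ∃ λ π → π ∈ perms (suc m) × q ≗ π
  extend (yes fixes) = fixLast p , ∈-perms⁺ p∈ fixed , ≗fixLast q-inj p≈ fixes
  extend (no moves) with injective⇒surjective q-inj (fromℕ m)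
  ... | i , hits with view i
  ...   | ‵fromℕ          = contradiction hits moves
  ...   | ‵inj₁ {i = a} _ = insertLast p a , ∈-perms⁺ p∈ (inserted a) , ≗insertLast q-inj p≈ hits

module _ (f : X → X) where

  iter-+ : ∀ a b x → iter (a +ℕ b) f x ≡ iter a f (iter b f x)
  iter-+ zero    b x = refl
  iter-+ (suc a) b x = cong f (iter-+ a b x)

  iter-periodic : ∀ d {x} → iter d f x ≡ x → ∀ r → iter (r *ℕ d) f x ≡ x
  iter-periodic d {x} per zero    = refl
  iter-periodic d {x} per (suc r) = trans (iter-+ d (r *ℕ d) x) (trans (cong (iter d f) (iter-periodic d per r)) per)

iter-cong : {f g : X → X} → f ≗ g → ∀ k x → iter k f x ≡ iter k g x
iter-cong f≗g zero    x = refl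
iter-cong {f = f} f≗g (suc k) x = trans (cong f (iter-cong f≗g k x)) (f≗g _)

iter-injective : {f : X → X} → Injective _≡_ _≡_ f → ∀ k → Injective _≡_ _≡_ (iter k f)
iter-injective f-inj zero    eq = eq
iter-injective f-inj (suc k) eq = iter-injective f-inj k (f-inj eq)

module _ {q : Fin n → Fin n} (q-inj : Injective _≡_ _≡_ q) where

  orbit-period : ∀ i → ∃ λ d → suc d ≤ n × iter (suc d) q i ≡ i
  orbit-period i with pigeonhole (ℕ.n<1+n n) (λ k → iter (toℕ k) q i)
  ... | k₁ , k₂ , k₁<k₂ , same with ℕ.m≤n⇒∃[o]m+o≡n k₁<k₂
  ...   | d , k₂≡ = d , suc-d≤n , iter-injective q-inj (toℕ k₁) returns
    where
    k₂≡k₁+1+d : toℕ k₁ +ℕ suc d ≡ toℕ k₂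
    k₂≡k₁+1+d = trans (ℕ.+-suc (toℕ k₁) d) k₂≡
    suc-d≤n : suc d ≤ n
    suc-d≤n = ℕ.≤-trans (ℕ.m≤n+m (suc d) (toℕ k₁))
                (ℕ.≤-trans (ℕ.≤-reflexive k₂≡k₁+1+d) (s≤s⁻¹ (toℕ<n k₂)))
    returns : iter (toℕ k₁) q (iter (suc d) q i) ≡ iter (toℕ k₁) q i
    returns = trans (sym (iter-+ q (toℕ k₁) (suc d) i))
                    (trans (cong (λ k → iter k q i) k₂≡k₁+1+d) (sym same))

  orbit-bounded : ∀ i k → ∃ λ k′ → k′ < n × iter k q i ≡ iter k′ q i
  orbit-bounded i k with orbit-period i
  ... | d , suc-d≤n , per =
    k % suc d , ℕ.<-≤-trans (m%n<n k (suc d)) suc-d≤n ,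
    (begin
      iter k q i                                            ≡⟨ cong (λ k → iter k q i) (m≡m%n+[m/n]*n k (suc d)) ⟩
      iter (k % suc d +ℕ (k / suc d) *ℕ suc d) q i          ≡⟨ iter-+ q (k % suc d) _ i ⟩
      iter (k % suc d) q (iter ((k / suc d) *ℕ suc d) q i)
        ≡⟨ cong (iter (k % suc d) q) (iter-periodic q (suc d) per (k / suc d)) ⟩
      iter (k % suc d) q i                                  ∎)
    where open ≡-Reasoning

isCycleMin? : (Fin n → Fin n) → Fin n → Bool
isCycleMin? {n} q i = all (λ j → toℕ i ≤ᵇ toℕ j) (map (λ k → iter k q i) (upTo n))

cycles : (Fin n → Fin n) → ℕ
cycles {n} q = length (filter (λ i → isCycleMin? q i Bool.≟ true) (allFin n))

isCycleMin-cong : {q q′ : Fin n → Fin n} → q ≗ q′ → ∀ i → isCycleMin? q i ≡ isCycleMin? q′ i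
isCycleMin-cong {n} q≗q′ i = cong (all _) (map-cong (λ k → iter-cong q≗q′ k i) (upTo n))

isCycleMin⇐ : {q : Fin n → Fin n} {i : Fin n} →
              (∀ k → toℕ i ≤ toℕ (iter k q i)) → T (isCycleMin? q i)
isCycleMin⇐ {n} {q} {i} i≤ = all⁻ _ (All.tabulate above)
  where
  above : ∀ {j} → j ∈ map (λ k → iter k q i) (upTo n) → T (toℕ i ≤ᵇ toℕ j)
  above j∈ with ∈-map⁻ (λ k → iter k q i) j∈
  ... | k , _ , refl = ℕ.≤⇒≤ᵇ (i≤ k)

isCycleMin⇒ : {q : Fin n → Fin n} → Injective _≡_ _≡_ q → {i : Fin n} →
              T (isCycleMin? q i) → ∀ k → toℕ i ≤ toℕ (iter k q i)
isCycleMin⇒ {n} {q} q-inj {i} min k with orbit-bounded q-inj i k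
... | k′ , k′<n , same rewrite same =
  ℕ.≤ᵇ⇒≤ _ _ (All.lookup (all⁺ _ _ min) (∈-map⁺ (λ k → iter k q i) (∈-upTo⁺ k′<n)))

extension-step : {p : Fin m → Fin m} {π : Fin (suc m) → Fin (suc m)} → Extension p π → ∀ y →
                 π (inject₁ y) ≡ inject₁ (p y) ⊎ (π (inject₁ y) ≡ fromℕ m × π (fromℕ m) ≡ inject₁ (p y))
extension-step {p = p} fixed y = inj₁ (fixLast-inject₁ p y)
extension-step {p = p} (inserted a) y with y ≟ a
... | yes refl = inj₂ (insertLast-inject₁-at p y , insertLast-fromℕ p y)
... | no y≢a   = inj₁ (insertLast-inject₁ p a y≢a)

module _ {p : Fin m → Fin m} {π : Fin (suc m) → Fin (suc m)} (e : Extension p π) (i : Fin m) where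

  orbit-extension⁺ : ∀ l → ∃ λ k → iter k π (inject₁ i) ≡ inject₁ (iter l p i)
  orbit-extension⁺ zero = zero , refl
  orbit-extension⁺ (suc l) with orbit-extension⁺ l | extension-step e (iter l p i)
  ... | k , at | inj₁ next           = suc k , trans (cong π at) next
  ... | k , at | inj₂ (to-last , next) = suc (suc k) , trans (cong (π ∘ π) at) (trans (cong π to-last) next)

  orbit-extension⁻ : ∀ k → (∃ λ l → iter k π (inject₁ i) ≡ inject₁ (iter l p i))
                          ⊎ (iter k π (inject₁ i) ≡ fromℕ m × ∃ λ l → π (fromℕ m) ≡ inject₁ (iter l p i))
  orbit-extension⁻ zero = inj₁ (zero , refl)
  orbit-extension⁻ (suc k) with orbit-extension⁻ k
  ... | inj₂ (at , l , next) = inj₁ (l , trans (cong π at) next)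
  ... | inj₁ (l , at) with extension-step e (iter l p i)
  ...   | inj₁ next              = inj₁ (suc l , trans (cong π at) next)
  ...   | inj₂ (to-last , next) = inj₂ (trans (cong π at) to-last , suc l , next)

  isCycleMin-extension : Injective _≡_ _≡_ p → isCycleMin? π (inject₁ i) ≡ isCycleMin? p i
  isCycleMin-extension p-inj = T-ext restrict-min extend-min
    where
    π-inj : Injective _≡_ _≡_ π
    π-inj = extension-injective p-inj e
    restrict-min : T (isCycleMin? π (inject₁ i)) → T (isCycleMin? p i)
    restrict-min min = isCycleMin⇐ λ l → let k , at = orbit-extension⁺ l in
      subst₂ _≤_ (toℕ-inject₁ i) (trans (cong toℕ at) (toℕ-inject₁ _)) (isCycleMin⇒ π-inj min k)
    extend-min : T (isCycleMin? p i) → T (isCycleMin? π (inject₁ i))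
    extend-min min = isCycleMin⇐ above
      where
      above : ∀ k → toℕ (inject₁ i) ≤ toℕ (iter k π (inject₁ i))
      above k with orbit-extension⁻ k
      ... | inj₁ (l , at) = subst₂ _≤_ (sym (toℕ-inject₁ i)) (trans (sym (toℕ-inject₁ _)) (cong toℕ (sym at)))
                                   (isCycleMin⇒ p-inj min l)
      ... | inj₂ (at , _) rewrite at | toℕ-inject₁ i | toℕ-fromℕ m = ℕ.<⇒≤ (toℕ<n i)

count : (Fin n → Bool) → ℕ
count f = ℕΣ.sum (λ i → if f i then 1 else 0)

length-filter-tabulate : (f : X → Bool) (g : Fin n → X) →
                         length (filter (λ x → f x Bool.≟ true) (tabulate g)) ≡ count (f ∘ g)
length-filter-tabulate {n = zero}  f g = refl
length-filter-tabulate {n = suc n} f g with f (g zero)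
... | true  = cong suc (length-filter-tabulate f (g ∘ suc))
... | false = length-filter-tabulate f (g ∘ suc)

cycles-extension : {p : Fin m → Fin m} {π : Fin (suc m) → Fin (suc m)} →
                   Injective _≡_ _≡_ p → Extension p π →
                   cycles π ≡ cycles p +ℕ (if isCycleMin? π (fromℕ m) then 1 else 0)
cycles-extension {m} {p} {π} p-inj e = begin
  cycles π                                                  ≡⟨ length-filter-tabulate (isCycleMin? π) id ⟩
  count (isCycleMin? π)                                     ≡⟨ ℕΣ.sum-init-last (λ i → if isCycleMin? π i then 1 else 0) ⟩
  count (isCycleMin? π ∘ inject₁) +ℕ _
    ≡⟨ cong (_+ℕ _) (ℕΣ.sum-cong-≗ (λ i → cong (λ b → if b then 1 else 0) (isCycleMin-extension e i p-inj))) ⟩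
  count (isCycleMin? p) +ℕ _                                 ≡⟨ cong (_+ℕ _) (sym (length-filter-tabulate (isCycleMin? p) id)) ⟩
  cycles p +ℕ (if isCycleMin? π (fromℕ m) then 1 else 0)    ∎
  where open ≡-Reasoning

cycles-fixLast : {p : Fin m → Fin m} → Injective _≡_ _≡_ p → cycles (fixLast p) ≡ suc (cycles p)
cycles-fixLast {m} {p} p-inj = trans (cycles-extension p-inj fixed)
  (trans (cong (λ b → cycles p +ℕ (if b then 1 else 0)) min) (ℕ.+-comm (cycles p) 1))
  where
  stays : ∀ k → iter k (fixLast p) (fromℕ m) ≡ fromℕ m
  stays zero    = refl
  stays (suc k) = trans (cong (fixLast p) (stays k)) (fixLast-fromℕ p)
  min : isCycleMin? (fixLast p) (fromℕ m) ≡ true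
  min = T-ext (λ _ → tt) (λ _ → isCycleMin⇐ (λ k → ℕ.≤-reflexive (cong toℕ (sym (stays k)))))

cycles-insertLast : {p : Fin m → Fin m} → Injective _≡_ _≡_ p → ∀ a → cycles (insertLast p a) ≡ cycles p
cycles-insertLast {m} {p} p-inj a = trans (cycles-extension p-inj (inserted a))
  (trans (cong (λ b → cycles p +ℕ (if b then 1 else 0)) not-min) (ℕ.+-identityʳ (cycles p)))
  where
  drops : toℕ (insertLast p a (fromℕ m)) < toℕ (fromℕ m)
  drops rewrite insertLast-fromℕ p a | toℕ-inject₁ (p a) | toℕ-fromℕ m = toℕ<n (p a)
  not-min : isCycleMin? (insertLast p a) (fromℕ m) ≡ false
  not-min = T-ext (λ min → ℕ.<⇒≱ drops (isCycleMin⇒ (insertLast-injective p p-inj a) min 1)) ⊥-elim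

-- The words of B_n^-

allVecs≡cartesianProduct : (xs : List X) → allVecs (suc m) xs ≡ cartesianProductWith _∷ᵥ_ xs (allVecs m xs)
allVecs≡cartesianProduct {m = m} xs = concatMap-map≡cartesianProductWith _∷ᵥ_ xs (allVecs m xs)

allVecs-unique : ∀ m {xs : List X} → Unique xs → Unique (allVecs m xs)
allVecs-unique zero    xs! = [] ∷ []
allVecs-unique (suc m) {xs} xs! rewrite allVecs≡cartesianProduct {m = m} xs =
  cartesianProductWith⁺ _∷ᵥ_ Vecₚ.∷-injective xs! (allVecs-unique m xs!)

∈-allVecs : ∀ {xs : List X} (v : Vec X m) → (∀ i → Vec.lookup v i ∈ xs) → v ∈ allVecs m xs
∈-allVecs []ᵥ         _   = here refl
∈-allVecs {m = suc m} {xs = xs} (x ∷ᵥ v) ∈xs rewrite allVecs≡cartesianProduct {m = m} xs =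
  ∈-cartesianProductWith⁺ _∷ᵥ_ (∈xs zero) (∈-allVecs v (∈xs ∘ suc))

allLetters-unique : Unique (allLetters n)
allLetters-unique {n} = cartesianProduct⁺ (((λ ()) ∷ []) ∷ [] ∷ []) (allFin⁺ n)

∈-allLetters : (l : Letter n) → l ∈ allLetters n
∈-allLetters (true  , k) = ∈-cartesianProduct⁺ {xs = true ∷ false ∷ []} (here refl) (∈-allFin k)
∈-allLetters (false , k) = ∈-cartesianProduct⁺ {xs = true ∷ false ∷ []} (there (here refl)) (∈-allFin k)

Bminus-unique : Unique (Bminus n)
Bminus-unique {n} = filter⁺ _ (filter⁺ _ (allVecs-unique n allLetters-unique))

isSignedPerm⇔injective : (w : Word n) → T (isSignedPerm w) ⇔ Injective _≡_ _≡_ (absPerm w)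
isSignedPerm⇔injective {n} w = mk⇔
  (λ signed {i} {j} → separates i j
     (All.lookup (all⁺ (pair i) (allFin n) (All.lookup (all⁺ row (allFin n) signed) (∈-allFin i))) (∈-allFin j)))
  (λ inj → all⁻ row {xs = allFin n} (All.tabulate λ {i} _ →
     all⁻ (pair i) {xs = allFin n} (All.tabulate λ {j} _ → separated i j inj)))
  where
  pair : Fin n → Fin n → Bool
  pair i j = not ⌊ absPerm w i ≟ absPerm w j ⌋ ∨ ⌊ i ≟ j ⌋
  row : Fin n → Bool
  row i = all (pair i) (allFin n)
  separates : ∀ i j → T (pair i j) → absPerm w i ≡ absPerm w j → i ≡ j
  separates i j t eq with absPerm w i ≟ absPerm w j | i ≟ j
  ... | yes _ | yes i≡j = i≡j
  ... | no neq | _      = contradiction eq neq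
  separated : ∀ i j → Injective _≡_ _≡_ (absPerm w) → T (pair i j)
  separated i j inj with absPerm w i ≟ absPerm w j | i ≟ j
  ... | yes _  | yes _  = tt
  ... | no _   | _      = tt
  ... | yes eq | no i≢j = i≢j (inj eq)

negWord : (Fin n → Fin n) → Word n
negWord q = Vec.tabulate (λ i → true , q i)

lookup-negWord : (q : Fin n → Fin n) (i : Fin n) → Vec.lookup (negWord q) i ≡ (true , q i)
lookup-negWord q = Vecₚ.lookup∘tabulate _

absPerm-negWord : (q : Fin n → Fin n) → absPerm (negWord q) ≗ q
absPerm-negWord q = cong absL ∘ lookup-negWord q

negWord-cong : {q q′ : Fin n → Fin n} → q ≗ q′ → negWord q ≡ negWord q′
negWord-cong q≗q′ = Vecₚ.tabulate-cong (cong (true ,_) ∘ q≗q′)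

negWord-injective : {q q′ : Fin n → Fin n} → negWord q ≡ negWord q′ → q ≗ q′
negWord-injective {q = q} {q′} eq i =
  trans (sym (absPerm-negWord q i)) (trans (cong (λ w → absPerm w i) eq) (absPerm-negWord q′ i))

∈-Bminus⁺ : {q : Fin n → Fin n} → Injective _≡_ _≡_ q → negWord q ∈ Bminus n
∈-Bminus⁺ {n} {q} q-inj =
  ∈-filter⁺ _ (∈-filter⁺ _ (∈-allVecs _ (λ _ → ∈-allLetters _)) (Equivalence.to T-≡ signed))
              (Equivalence.to T-≡ negative)
  where
  signed : T (isSignedPerm (negWord q))
  signed = Equivalence.from (isSignedPerm⇔injective (negWord q)) λ eq →
    q-inj (trans (sym (absPerm-negWord q _)) (trans eq (absPerm-negWord q _)))
  negative : T (allNeg (negWord q))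
  negative = all⁻ _ {xs = allFin n} (All.tabulate λ {i} _ → subst T (sym (cong isNeg (lookup-negWord q i))) tt)

∈-Bminus⁻ : {w : Word n} → w ∈ Bminus n → Injective _≡_ _≡_ (absPerm w) × w ≡ negWord (absPerm w)
∈-Bminus⁻ {n} {w} w∈ with ∈-filter⁻ _ {xs = filter _ (allVecs n (allLetters n))} w∈
... | w∈′ , negative with ∈-filter⁻ _ {xs = allVecs n (allLetters n)} w∈′
...   | _ , signed =
  Equivalence.to (isSignedPerm⇔injective w) (Equivalence.from T-≡ signed) ,
  trans (sym (Vecₚ.tabulate∘lookup w)) (Vecₚ.tabulate-cong λ i →
    cong (_, absPerm w i) (Equivalence.to T-≡ (All.lookup (all⁺ _ (allFin n) (Equivalence.from T-≡ negative)) (∈-allFin i))))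

negWords : (n : ℕ) → List (Word n)
negWords n = map negWord (perms n)

negWords-unique : ∀ n → Unique (negWords n)
negWords-unique zero    = [] ∷ []
negWords-unique (suc m) rewrite map-concatMap negWord extensions (perms m) =
  Unique-concatMap (map negWord ∘ extensions) negWord decode (negWords-unique m) block-unique decodes
  where
  decode : Word (suc m) → Word m
  decode w = negWord (restrict (absPerm w))
  decodes : ∀ p {w} → w ∈ map negWord (extensions p) → decode w ≡ negWord p
  decodes p w∈ with ∈-map⁻ negWord {xs = extensions p} w∈
  ... | π , π∈ , refl = negWord-cong λ y →
    trans (restrict-cong (absPerm-negWord π) y) (restrict-extension (∈-extensions⁻ π∈) y)
  block-unique : ∀ p → Unique (map negWord (extensions p))
  block-unique p = All.tabulate fixed≢inserted ∷ subst Unique (map-∘ (allFin m)) (map⁺ inserted-injective (allFin⁺ m))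
    where
    fixed≢inserted : ∀ {w} → w ∈ map negWord (map (insertLast p) (allFin m)) → negWord (fixLast p) ≢ w
    fixed≢inserted w∈ eq with ∈-map⁻ negWord {xs = map (insertLast p) (allFin m)} w∈
    ... | π , π∈ , refl with ∈-map⁻ (insertLast p) π∈
    ...   | a , _ , refl = fromℕ≢inject₁ (begin
      fromℕ m                  ≡⟨ sym (fixLast-fromℕ p) ⟩
      fixLast p (fromℕ m)      ≡⟨ negWord-injective {q = fixLast p} {insertLast p a} eq (fromℕ m) ⟩
      insertLast p a (fromℕ m) ≡⟨ insertLast-fromℕ p a ⟩
      inject₁ (p a)            ∎)
      where open ≡-Reasoning
    inserted-injective : ∀ {a b} → negWord (insertLast p a) ≡ negWord (insertLast p b) → a ≡ b
    inserted-injective {a} {b} eq with a ≟ b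
    ... | yes a≡b = a≡b
    ... | no a≢b  = contradiction (begin
      fromℕ m                  ≡⟨ sym (insertLast-inject₁-at p a) ⟩
      insertLast p a (inject₁ a) ≡⟨ negWord-injective {q = insertLast p a} {insertLast p b} eq (inject₁ a) ⟩
      insertLast p b (inject₁ a) ≡⟨ insertLast-inject₁ p b a≢b ⟩
      inject₁ (p a)            ∎) fromℕ≢inject₁
      where open ≡-Reasoning

Bminus↭negWords : Bminus n ↭ negWords n
Bminus↭negWords {n} = unique∧⇔⇒↭ Bminus-unique (negWords-unique n) (mk⇔ to from)
  where
  to : ∀ {w} → w ∈ Bminus n → w ∈ negWords n
  to {w} w∈ with ∈-Bminus⁻ w∈
  ... | inj , w≡ with perms-complete inj
  ...   | p , p∈ , ≗p = subst (_∈ negWords n) (trans (negWord-cong (sym ∘ ≗p)) (sym w≡)) (∈-map⁺ negWord p∈)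
  from : ∀ {w} → w ∈ negWords n → w ∈ Bminus n
  from w∈ with ∈-map⁻ negWord w∈
  ... | q , q∈ , refl = ∈-Bminus⁺ (perms-injective q∈)

cycles-cong : {q q′ : Fin n → Fin n} → q ≗ q′ → cycles q ≡ cycles q′
cycles-cong {q = q} {q′} q≗q′ = begin
  cycles q                ≡⟨ length-filter-tabulate (isCycleMin? q) id ⟩
  count (isCycleMin? q)   ≡⟨ ℕΣ.sum-cong-≗ (λ i → cong (λ b → if b then 1 else 0) (isCycleMin-cong q≗q′ i)) ⟩
  count (isCycleMin? q′)  ≡⟨ sym (length-filter-tabulate (isCycleMin? q′) id) ⟩
  cycles q′               ∎
  where open ≡-Reasoning

cyc-negWord : (q : Fin n → Fin n) → cyc (negWord q) ≡ cycles q
cyc-negWord q = cycles-cong (absPerm-negWord q)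

Neg-negWord : (q : Fin n → Fin n) → Neg (negWord q) ≡ allFin n
Neg-negWord q = filter-all _ (All.universal (λ i → cong isNeg (lookup-negWord q i)) _)

neg-negWord : (q : Fin n → Fin n) → neg (negWord q) ≡ n
neg-negWord q = trans (cong length (Neg-negWord q)) (length-tabulate id)

triangle : ℕ → ℕ
triangle n = ℕΣ.sum {n} (λ i → suc (toℕ i))

triangle-closed : ∀ n → triangle n ≡ (n *ℕ (n +ℕ 1)) / 2
triangle-closed n = trans (sym (m*n/n≡m (triangle n) 2)) (cong (_/ 2) (twice n))
  where
  twice : ∀ n → triangle n *ℕ 2 ≡ n *ℕ (n +ℕ 1)
  twice zero    = refl
  twice (suc n) = begin
    triangle (suc n) *ℕ 2                      ≡⟨ cong (_*ℕ 2) (ℕΣ.sum-init-last {n} (λ i → suc (toℕ i))) ⟩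
    (ℕΣ.sum {n} (λ i → suc (toℕ (inject₁ i))) +ℕ suc (toℕ (fromℕ n))) *ℕ 2
      ≡⟨ cong₂ (λ s t → (s +ℕ suc t) *ℕ 2) (ℕΣ.sum-cong-≗ {n} (cong suc ∘ toℕ-inject₁)) (toℕ-fromℕ n) ⟩
    (triangle n +ℕ suc n) *ℕ 2                 ≡⟨ ℕ.*-distribʳ-+ 2 (triangle n) (suc n) ⟩
    triangle n *ℕ 2 +ℕ suc n *ℕ 2              ≡⟨ cong (_+ℕ suc n *ℕ 2) (twice n) ⟩
    n *ℕ (n +ℕ 1) +ℕ suc n *ℕ 2
      ≡⟨ solve 1 (λ n → n :* (n :+ con 1) :+ (con 1 :+ n) :* con 2 := (con 1 :+ n) :* ((con 1 :+ n) :+ con 1)) refl n ⟩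
    suc n *ℕ (suc n +ℕ 1)                      ∎
    where
    open ≡-Reasoning
    open +-*-Solver using (solve; _:+_; _:*_; _:=_; con)

sum-tabulate : (f : Fin n → ℕ) → sum (tabulate f) ≡ ℕΣ.sum f
sum-tabulate {zero}  f = refl
sum-tabulate {suc n} f = cong (f zero +ℕ_) (sum-tabulate (f ∘ suc))

-- nsum only sees the values |σ(i)|, which are 1, …, n in some order.
nsum-negWord : {q : Fin n → Fin n} → Injective _≡_ _≡_ q → nsum (negWord q) ≡ (n *ℕ (n +ℕ 1)) / 2
nsum-negWord {n} {q} q-inj = begin
  nsum (negWord q)                               ≡⟨ cong (foldr step 0) (Neg-negWord q) ⟩
  foldr step 0 (allFin n)                        ≡⟨ foldr-map _+ℕ_ _ 0 (allFin n) ⟨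
  sum (map (λ i → suc (toℕ (absPerm (negWord q) i))) (allFin n))
    ≡⟨ cong sum (map-cong (cong (suc ∘ toℕ) ∘ absPerm-negWord q) (allFin n)) ⟩
  sum (map (suc ∘ toℕ ∘ q) (allFin n))           ≡⟨ cong sum (map-∘ {g = suc ∘ toℕ} {f = q} (allFin n)) ⟩
  sum (map (suc ∘ toℕ) (map q (allFin n)))       ≡⟨ sum-↭ (↭.map⁺ (suc ∘ toℕ) values↭) ⟩
  sum (map (suc ∘ toℕ) (allFin n))               ≡⟨ cong sum (map-tabulate {n = n} id (suc ∘ toℕ)) ⟩
  sum (tabulate {n = n} (suc ∘ toℕ))             ≡⟨ sum-tabulate {n} (suc ∘ toℕ) ⟩
  triangle n                                     ≡⟨ triangle-closed n ⟩
  (n *ℕ (n +ℕ 1)) / 2                            ∎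
  where
  open ≡-Reasoning
  step : Fin n → ℕ → ℕ
  step i acc = suc (toℕ (absPerm (negWord q) i)) +ℕ acc
  values↭ : map q (allFin n) ↭ allFin n
  values↭ = unique∧⇔⇒↭ (map⁺ q-inj (allFin⁺ n)) (allFin⁺ n) (mk⇔ (λ _ → ∈-allFin _) hit)
    where
    hit : ∀ {j} → j ∈ allFin n → j ∈ map q (allFin n)
    hit {j} _ with injective⇒surjective q-inj j
    ... | i , refl = ∈-map⁺ q (∈-allFin i)

weakDeficiency? : (Fin n → Fin n) → Fin n → Bool
weakDeficiency? q j = toℕ (q j) ≤ᵇ toℕ j

-- The condition tested by inEXC for the preimage u = σ(i) and the value v = σ(j).
excTest : Letter n → Letter n → Fin n → Bool
excTest u v j = ⌊ absL u ≟ j ⌋ ∧ ((isNeg v ∧ ⌊ absL v ≟ j ⌋) ∨ ⌊ val u <ℤ? val v ⌋)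

-- For negative letters σ(j) > σ(i) means |σ(j)| < |σ(i)|, so together with
-- σ(j) = -j this says |σ(j)| ≤ j.
excTest-negative : {a b j : Fin n} → T (excTest (true , a) (true , b) j) ⇔ (a ≡ j × toℕ b ≤ toℕ j)
excTest-negative {a = a} {b} {j} = mk⇔ to from
  where
  to : T (excTest (true , a) (true , b) j) → a ≡ j × toℕ b ≤ toℕ j
  to t with a ≟ j
  ... | yes refl with Equivalence.to (T-∨ {⌊ b ≟ a ⌋} {⌊ -[1+ toℕ a ] <ℤ? -[1+ toℕ b ] ⌋}) t
  ...   | inj₁ stays = refl , ℕ.≤-reflexive (cong toℕ (toWitness {a? = b ≟ a} stays))
  ...   | inj₂ drops with toWitness {a? = -[1+ toℕ a ] <ℤ? -[1+ toℕ b ]} drops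
  ...     | ℤ.-<- b<a = refl , ℕ.<⇒≤ b<a
  from : a ≡ j × toℕ b ≤ toℕ j → T (excTest (true , a) (true , b) j)
  from (refl , b≤a) = Equivalence.from T-∧ (fromWitness {a? = a ≟ a} refl , Equivalence.from T-∨ test)
    where
    test : T (⌊ b ≟ a ⌋) ⊎ T ⌊ -[1+ toℕ a ] <ℤ? -[1+ toℕ b ] ⌋
    test with ℕ.m≤n⇒m<n∨m≡n b≤a
    ... | inj₁ b<a = inj₂ (fromWitness {a? = -[1+ toℕ a ] <ℤ? -[1+ toℕ b ]} (ℤ.-<- b<a))
    ... | inj₂ b≡a = inj₁ (fromWitness {a? = b ≟ a} (toℕ-injective b≡a))

inEXC-negWord : {q : Fin n → Fin n} → Injective _≡_ _≡_ q → ∀ j → inEXC (negWord q) j ≡ weakDeficiency? q j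
inEXC-negWord {n} {q} q-inj j = T-ext to from
  where
  test≡ : ∀ i → excTest (Vec.lookup (negWord q) i) (Vec.lookup (negWord q) j) j ≡ excTest (true , q i) (true , q j) j
  test≡ i = cong₂ (λ u v → excTest u v j) (lookup-negWord q i) (lookup-negWord q j)
  to : T (inEXC (negWord q) j) → T (weakDeficiency? q j)
  to t with find (any⁻ _ (allFin n) t)
  ... | i , _ , tᵢ = ℕ.≤⇒≤ᵇ (proj₂ (Equivalence.to (excTest-negative {a = q i} {q j} {j}) (subst T (test≡ i) tᵢ)))
  from : T (weakDeficiency? q j) → T (inEXC (negWord q) j)
  from t with injective⇒surjective q-inj j
  ... | i , qi≡j = any⁺ _ (lose (∈-allFin i)
    (subst T (sym (test≡ i)) (Equivalence.from (excTest-negative {a = q i} {q j} {j}) (qi≡j , ℕ.≤ᵇ⇒≤ _ _ t))))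

module _ (π : Fin (suc m) → Fin (suc m)) where

  weakDeficiency-fromℕ : weakDeficiency? π (fromℕ m) ≡ true
  weakDeficiency-fromℕ = Equivalence.to T-≡ (ℕ.≤⇒≤ᵇ (≤fromℕ (π (fromℕ m))))

  weakDeficiency-inject₁ : {p : Fin m → Fin m} {j : Fin m} →
                           π (inject₁ j) ≡ inject₁ (p j) → weakDeficiency? π (inject₁ j) ≡ weakDeficiency? p j
  weakDeficiency-inject₁ {p} {j} eq rewrite eq | toℕ-inject₁ (p j) | toℕ-inject₁ j = refl

  weakDeficiency-toLast : {j : Fin m} → π (inject₁ j) ≡ fromℕ m → weakDeficiency? π (inject₁ j) ≡ false
  weakDeficiency-toLast {j} eq rewrite eq | toℕ-fromℕ m | toℕ-inject₁ j =
    T-ext (λ m≤j → ℕ.<⇒≱ (toℕ<n j) (ℕ.≤ᵇ⇒≤ _ _ m≤j)) ⊥-elim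

-- The signed sum over permutations

module SignedSum {c ℓ : Level} (R : CommutativeRing c ℓ) where

  open CommutativeRing R hiding (zero) renaming (refl to ≈-refl; sym to ≈-sym; trans to ≈-trans)
  open RingOps R
  open RingProperties ring using (-1*x≈-x; -‿distribˡ-*; x[y-z]≈xy-xz)
  open AbelianGroupProperties +-abelianGroup using (⁻¹-anti-homo‿-)
  module Sum     = SemiringSum semiring
  module Product = CommutativeMonoidSum *-commutativeMonoid
  open CommutativeSemigroupProperties +-commutativeSemigroup using (interchange)
  open CommutativeSemigroupProperties *-commutativeSemigroup using (x∙yz≈y∙xz)
  open CommutativeMonoidSolver *-commutativeMonoid using (solve; _⊕_; _⊜_)
  open SetoidPermutation setoid using (foldr-commMonoid)
  open SetoidReasoning setoid

  ∑ ∏ : (Fin n → Carrier) → Carrier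
  ∑ = Sum.sum
  ∏ = Product.sum

  sumL-cong : (xs : List X) {f g : X → Carrier} → (∀ {a} → a ∈ xs → f a ≈ g a) → sumL xs f ≈ sumL xs g
  sumL-cong []       f≈g = ≈-refl
  sumL-cong (x ∷ xs) f≈g = +-cong (f≈g (here refl)) (sumL-cong xs (f≈g ∘ there))

  sumL-++ : (xs ys : List X) (f : X → Carrier) → sumL (xs ++ ys) f ≈ sumL xs f + sumL ys f
  sumL-++ []       ys f = ≈-sym (+-identityˡ _)
  sumL-++ (x ∷ xs) ys f = ≈-trans (+-congˡ (sumL-++ xs ys f)) (≈-sym (+-assoc _ _ _))

  sumL-concatMap : (g : X → List Y) (xs : List X) (f : Y → Carrier) →
                   sumL (concatMap g xs) f ≈ sumL xs (λ a → sumL (g a) f)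
  sumL-concatMap g []       f = ≈-refl
  sumL-concatMap g (x ∷ xs) f = ≈-trans (sumL-++ (g x) (concatMap g xs) f) (+-congˡ (sumL-concatMap g xs f))

  sumL-map : (g : X → Y) (xs : List X) (f : Y → Carrier) → sumL (map g xs) f ≡ sumL xs (f ∘ g)
  sumL-map g []       f = refl
  sumL-map g (x ∷ xs) f = cong (f (g x) +_) (sumL-map g xs f)

  sumL-+ : (xs : List X) (f g : X → Carrier) → sumL xs (λ a → f a + g a) ≈ sumL xs f + sumL xs g
  sumL-+ []       f g = ≈-sym (+-identityˡ _)
  sumL-+ (x ∷ xs) f g = ≈-trans (+-congˡ (sumL-+ xs f g)) (interchange (f x) (g x) _ _)

  *-distribˡ-sumL : (xs : List X) (k : Carrier) (f : X → Carrier) → sumL xs (λ a → k * f a) ≈ k * sumL xs f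
  *-distribˡ-sumL []       k f = ≈-sym (zeroʳ k)
  *-distribˡ-sumL (x ∷ xs) k f = ≈-trans (+-congˡ (*-distribˡ-sumL xs k f)) (≈-sym (distribˡ k _ _))

  sumL-∑-comm : (xs : List X) (h : X → Fin m → Carrier) →
                sumL xs (λ p → ∑ (h p)) ≈ ∑ (λ a → sumL xs (λ p → h p a))
  sumL-∑-comm {m = m} []       h = ≈-sym (Sum.sum-replicate-zero m)
  sumL-∑-comm         (x ∷ xs) h = ≈-trans (+-congˡ (sumL-∑-comm xs h)) (≈-sym (Sum.∑-distrib-+ (h x) _))

  sumL-↭ : {xs ys : List X} (f : X → Carrier) → xs ↭ ys → sumL xs f ≈ sumL ys f
  sumL-↭ {xs = xs} {ys} f xs↭ys = begin
    sumL xs f                  ≡⟨ foldr-map _+_ f 0# xs ⟨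
    foldr _+_ 0# (map f xs)    ≈⟨ foldr-commMonoid +-isCommutativeMonoid (↭⇒↭ₛ′ isEquivalence (↭.map⁺ f xs↭ys)) ⟩
    foldr _+_ 0# (map f ys)    ≡⟨ foldr-map _+_ f 0# ys ⟩
    sumL ys f                  ∎

  prodFin≡∏ : (f : Fin m → Carrier) → prodFin m f ≡ ∏ f
  prodFin≡∏ f = foldr-allFin _*_ 1# f

  sumL-allFin : (f : Fin m → Carrier) → sumL (allFin m) f ≡ ∑ f
  sumL-allFin f = foldr-allFin _+_ 0# f

  ∏-updateAt : (f : Fin m → Carrier) (a : Fin m) (k : Carrier) →
               ∏ (updateAt f a (λ _ → k)) ≈ k * ∏ (updateAt f a (λ _ → 1#))
  ∏-updateAt f zero    k = *-congˡ (≈-sym (*-identityˡ _))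
  ∏-updateAt f (suc a) k = ≈-trans (*-congˡ (∏-updateAt (f ∘ suc) a k)) (x∙yz≈y∙xz (f zero) k _)

  ∏-zero : (f : Fin m → Carrier) (b : Fin m) → f b ≈ 0# → ∏ f ≈ 0#
  ∏-zero f zero    fb≈0 = ≈-trans (*-congʳ fb≈0) (zeroˡ _)
  ∏-zero f (suc b) fb≈0 = ≈-trans (*-congˡ (∏-zero (f ∘ suc) b fb≈0)) (zeroʳ _)

  choose : (Fin n → Fin n) → (Fin n → Carrier) → (Fin n → Carrier) → Fin n → Carrier
  choose q x y j = if weakDeficiency? q j then x j else y j

  weight : (Fin n → Carrier) → (Fin n → Carrier) → (Fin n → Fin n) → Carrier
  weight x y q = pow (- 1#) (cycles q) * ∏ (choose q x y)

  eraseAt : (Fin m → Carrier) → Fin m → Fin m → Carrier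
  eraseAt v a = updateAt v a (λ _ → 1#)

  eraseAt-choose : (q : Fin m → Fin m) (x y : Fin m → Carrier) (a : Fin m) →
                   eraseAt (choose q x y) a ≗ choose q (eraseAt x a) (eraseAt y a)
  eraseAt-choose q x y a j with j ≟ a
  ... | yes refl = trans (updateAt-updates j (choose q x y))
                         (sym (trans (if-cong₂ _ (updateAt-updates j x) (updateAt-updates j y)) (if-eta _)))
  ... | no j≢a   = trans (updateAt-minimal j a (choose q x y) j≢a)
                         (sym (if-cong₂ _ (updateAt-minimal j a x j≢a) (updateAt-minimal j a y j≢a)))

  module _ (x y : Fin (suc m) → Carrier) {p : Fin m → Fin m} (p-inj : Injective _≡_ _≡_ p) where

    weight-fixLast : weight x y (fixLast p) ≈ - x (fromℕ m) * weight (init x) (init y) p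
    weight-fixLast = begin
      pow (- 1#) (cycles (fixLast p)) * ∏ (choose (fixLast p) x y)
        ≈⟨ *-cong (reflexive (cong (pow (- 1#)) (cycles-fixLast p-inj))) (Product.sum-init-last (choose (fixLast p) x y)) ⟩
      - 1# * sgn * (∏ (init (choose (fixLast p) x y)) * choose (fixLast p) x y (fromℕ m))
        ≈⟨ *-congˡ (*-cong (Product.sum-cong-≋ (reflexive ∘ chooseᵢ))
                           (reflexive (if-cong (weakDeficiency-fromℕ (fixLast p))))) ⟩
      - 1# * sgn * (W * x (fromℕ m))
        ≈⟨ solve 4 (λ n sgn W u → (n ⊕ sgn) ⊕ (W ⊕ u) ⊜ (n ⊕ u) ⊕ (sgn ⊕ W)) ≈-refl (- 1#) sgn W (x (fromℕ m)) ⟩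
      - 1# * x (fromℕ m) * (sgn * W)
        ≈⟨ *-congʳ (-1*x≈-x _) ⟩
      - x (fromℕ m) * (sgn * W) ∎
      where
      sgn W : Carrier
      sgn = pow (- 1#) (cycles p)
      W = ∏ (choose p (init x) (init y))
      chooseᵢ : ∀ j → choose (fixLast p) x y (inject₁ j) ≡ choose p (init x) (init y) j
      chooseᵢ j = if-cong (weakDeficiency-inject₁ (fixLast p) {p} (fixLast-inject₁ p j))

    weight-insertLast : ∀ a → weight x y (insertLast p a) ≈
                        x (fromℕ m) * (y (inject₁ a) * weight (eraseAt (init x) a) (eraseAt (init y) a) p)
    weight-insertLast a = begin
      pow (- 1#) (cycles (insertLast p a)) * ∏ (choose (insertLast p a) x y)
        ≈⟨ *-cong (reflexive (cong (pow (- 1#)) (cycles-insertLast p-inj a))) (Product.sum-init-last (choose (insertLast p a) x y)) ⟩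
      sgn * (∏ (init (choose (insertLast p a) x y)) * choose (insertLast p a) x y (fromℕ m))
        ≈⟨ *-congˡ (*-cong (Product.sum-cong-≋ (reflexive ∘ chooseᵢ))
                           (reflexive (if-cong (weakDeficiency-fromℕ (insertLast p a))))) ⟩
      sgn * (∏ (updateAt (choose p (init x) (init y)) a (λ _ → y (inject₁ a))) * x (fromℕ m))
        ≈⟨ *-congˡ (*-congʳ (∏-updateAt _ a _)) ⟩
      sgn * (y (inject₁ a) * ∏ (eraseAt (choose p (init x) (init y)) a) * x (fromℕ m))
        ≈⟨ *-congˡ (*-congʳ (*-congˡ (Product.sum-cong-≋ (reflexive ∘ eraseAt-choose p (init x) (init y) a)))) ⟩
      sgn * (y (inject₁ a) * W * x (fromℕ m))
        ≈⟨ solve 4 (λ c v W u → c ⊕ ((v ⊕ W) ⊕ u) ⊜ u ⊕ (v ⊕ (c ⊕ W))) ≈-refl sgn (y (inject₁ a)) W (x (fromℕ m)) ⟩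
      x (fromℕ m) * (y (inject₁ a) * (sgn * W)) ∎
      where
      sgn W : Carrier
      sgn = pow (- 1#) (cycles p)
      W = ∏ (choose p (eraseAt (init x) a) (eraseAt (init y) a))
      chooseᵢ : ∀ j → choose (insertLast p a) x y (inject₁ j) ≡
                      updateAt (choose p (init x) (init y)) a (λ _ → y (inject₁ a)) j
      chooseᵢ j with j ≟ a
      ... | yes refl = trans (if-cong (weakDeficiency-toLast (insertLast p j) (insertLast-inject₁-at p j)))
                             (sym (updateAt-updates j (choose p (init x) (init y))))
      ... | no j≢a   = trans (if-cong (weakDeficiency-inject₁ (insertLast p a) {p} (insertLast-inject₁ p a j≢a)))
                             (sym (updateAt-minimal j a (choose p (init x) (init y)) j≢a))

  closedForm : (m : ℕ) → (Fin m → Carrier) → (Fin m → Carrier) → Carrier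
  closedForm zero    x y = 1#
  closedForm (suc m) x y = pow (- 1#) (suc m) * x (fromℕ m) * ∏ (λ j → init x j - init y j)

  closedForm-eraseAt-inject₁ : (x y : Fin (suc m) → Carrier) (b : Fin m) →
                               closedForm (suc m) (eraseAt x (inject₁ b)) (eraseAt y (inject₁ b)) ≈ 0#
  closedForm-eraseAt-inject₁ x y b = ≈-trans (*-congˡ (∏-zero _ b cancels)) (zeroʳ _)
    where
    cancels : eraseAt x (inject₁ b) (inject₁ b) - eraseAt y (inject₁ b) (inject₁ b) ≈ 0#
    cancels = ≈-trans (reflexive (cong₂ _-_ (updateAt-updates (inject₁ b) x) (updateAt-updates (inject₁ b) y))) (-‿inverseʳ 1#)

  closedForm-eraseAt-fromℕ : (x y : Fin (suc m) → Carrier) →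
                             closedForm (suc m) (eraseAt x (fromℕ m)) (eraseAt y (fromℕ m)) ≈
                             pow (- 1#) (suc m) * ∏ (λ j → init x j - init y j)
  closedForm-eraseAt-fromℕ {m} x y = *-cong (≈-trans (*-congˡ (reflexive (updateAt-updates (fromℕ m) x))) (*-identityʳ _))
    (Product.sum-cong-≋ {m} λ j → reflexive (cong₂ _-_ (updateAt-minimal (inject₁ j) (fromℕ m) x (fromℕ≢inject₁ ∘ sym))
                                                   (updateAt-minimal (inject₁ j) (fromℕ m) y (fromℕ≢inject₁ ∘ sym))))

  factor-difference : ∀ s u v w P → - u * (s * v * P) + u * (w * (s * P)) ≈ - 1# * s * u * (P * (v - w))
  factor-difference s u v w P = begin
    - u * (s * v * P) + u * (w * (s * P))
      ≈⟨ +-cong (≈-trans (≈-sym (-‿distribˡ-* u _))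
                         (-‿cong (solve 4 (λ u s v P → u ⊕ ((s ⊕ v) ⊕ P) ⊜ ((s ⊕ u) ⊕ P) ⊕ v) ≈-refl u s v P)))
                (solve 4 (λ u w s P → u ⊕ (w ⊕ (s ⊕ P)) ⊜ ((s ⊕ u) ⊕ P) ⊕ w) ≈-refl u w s P) ⟩
    - (Q * v) + Q * w               ≈⟨ +-comm _ _ ⟩
    Q * w - Q * v                   ≈⟨ ⁻¹-anti-homo‿- (Q * v) (Q * w) ⟨
    - (Q * v - Q * w)               ≈⟨ -‿cong (x[y-z]≈xy-xz Q v w) ⟨
    - (Q * (v - w))                 ≈⟨ -1*x≈-x _ ⟨
    - 1# * (Q * (v - w))
      ≈⟨ solve 5 (λ n s u P d → n ⊕ (((s ⊕ u) ⊕ P) ⊕ d) ⊜ ((n ⊕ s) ⊕ u) ⊕ (P ⊕ d)) ≈-refl (- 1#) s u P (v - w) ⟩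
    - 1# * s * u * (P * (v - w))    ∎
    where
    Q : Carrier
    Q = s * u * P

  closedForm-step : ∀ m (x y : Fin (suc m) → Carrier) →
    - x (fromℕ m) * closedForm m (init x) (init y)
      + ∑ (λ a → x (fromℕ m) * (init y a * closedForm m (eraseAt (init x) a) (eraseAt (init y) a)))
    ≈ closedForm (suc m) x y
  closedForm-step zero x y = begin
    - x zero * 1# + 0#          ≈⟨ +-identityʳ _ ⟩
    - x zero * 1#               ≈⟨ *-identityʳ _ ⟩
    - x zero                    ≈⟨ -1*x≈-x _ ⟨
    - 1# * x zero               ≈⟨ *-congʳ (*-identityʳ _) ⟨
    - 1# * 1# * x zero          ≈⟨ *-identityʳ _ ⟨
    - 1# * 1# * x zero * 1#     ∎
  closedForm-step (suc k) x y = begin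
    - xL * (s * xl * P) + ∑ g              ≈⟨ +-congˡ (Sum.sum-init-last g) ⟩
    - xL * (s * xl * P) + (∑ (init g) + g (fromℕ k))
      ≈⟨ +-congˡ (≈-trans (+-congʳ vanishes) (+-identityˡ _)) ⟩
    - xL * (s * xl * P) + g (fromℕ k)
      ≈⟨ +-congˡ (*-congˡ (*-congˡ (closedForm-eraseAt-fromℕ (init x) (init y)))) ⟩
    - xL * (s * xl * P) + xL * (yl * (s * P))   ≈⟨ factor-difference s xL xl yl P ⟩
    - 1# * s * xL * (P * (xl - yl))             ≈⟨ *-congˡ (Product.sum-init-last (λ j → init x j - init y j)) ⟨
    closedForm (suc (suc k)) x y                ∎
    where
    xL xl yl s P : Carrier
    xL = x (fromℕ (suc k))
    xl = init x (fromℕ k)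
    yl = init y (fromℕ k)
    s = pow (- 1#) (suc k)
    P = ∏ (λ j → init (init x) j - init (init y) j)
    g : Fin (suc k) → Carrier
    g a = xL * (init y a * closedForm (suc k) (eraseAt (init x) a) (eraseAt (init y) a))
    vanishes : ∑ (init g) ≈ 0#
    vanishes = ≈-trans (Sum.sum-cong-≋ λ b →
                 ≈-trans (*-congˡ (≈-trans (*-congˡ (closedForm-eraseAt-inject₁ (init x) (init y) b)) (zeroʳ _))) (zeroʳ _))
                       (Sum.sum-replicate-zero k)

  sumL-perms-weight : ∀ m (x y : Fin m → Carrier) → sumL (perms m) (weight x y) ≈ closedForm m x y
  sumL-perms-weight zero    x y = ≈-trans (+-identityʳ _) (*-identityˡ _)
  sumL-perms-weight (suc m) x y = begin
    sumL (perms (suc m)) (weight x y)                        ≈⟨ sumL-concatMap extensions (perms m) (weight x y) ⟩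
    sumL (perms m) (λ p → sumL (extensions p) (weight x y))  ≈⟨ sumL-cong (perms m) (extensions-sum ∘ perms-injective) ⟩
    sumL (perms m) (λ p → - xL * weight x′ y′ p + ∑ (inserted-weight p))
      ≈⟨ sumL-+ (perms m) _ _ ⟩
    sumL (perms m) (λ p → - xL * weight x′ y′ p) + sumL (perms m) (λ p → ∑ (inserted-weight p))
      ≈⟨ +-cong (*-distribˡ-sumL (perms m) (- xL) (weight x′ y′)) (sumL-∑-comm (perms m) inserted-weight) ⟩
    - xL * sumL (perms m) (weight x′ y′) + ∑ (λ a → sumL (perms m) (λ p → inserted-weight p a))
      ≈⟨ +-cong (*-congˡ (sumL-perms-weight m x′ y′)) (Sum.sum-cong-≋ λ a → ≈-trans (*-distribˡ-sumL (perms m) xL _)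
           (*-congˡ (≈-trans (*-distribˡ-sumL (perms m) (y′ a) _) (*-congˡ (sumL-perms-weight m (eraseAt x′ a) (eraseAt y′ a)))))) ⟩
    - xL * closedForm m x′ y′ + ∑ (λ a → xL * (y′ a * closedForm m (eraseAt x′ a) (eraseAt y′ a)))
      ≈⟨ closedForm-step m x y ⟩
    closedForm (suc m) x y ∎
    where
    xL : Carrier
    xL = x (fromℕ m)
    x′ y′ : Fin m → Carrier
    x′ = init x
    y′ = init y
    inserted-weight : (Fin m → Fin m) → Fin m → Carrier
    inserted-weight p a = xL * (y′ a * weight (eraseAt x′ a) (eraseAt y′ a) p)
    extensions-sum : ∀ {p} → Injective _≡_ _≡_ p →
                     sumL (extensions p) (weight x y) ≈ - xL * weight x′ y′ p + ∑ (inserted-weight p)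
    extensions-sum {p} p-inj = +-cong (weight-fixLast x y p-inj)
      (≈-trans (reflexive (trans (sumL-map (insertLast p) (allFin m) (weight x y)) (sumL-allFin {m} (weight x y ∘ insertLast p))))
               (Sum.sum-cong-≋ (weight-insertLast x y p-inj)))

  summand-negWord : {q : Fin n → Fin n} → Injective _≡_ _≡_ q → (x : Fin n → Carrier) (s t : Carrier) →
    let σ = negWord q in
    pow (- 1#) (cyc σ) * pow s (neg σ) * pow t (nsum σ) * excWeight x σ
    ≈ pow s n * pow t ((n *ℕ (n +ℕ 1)) / 2) * weight x (λ _ → 1#) q
  summand-negWord {n} {q} q-inj x s t = begin
    pow (- 1#) (cyc σ) * pow s (neg σ) * pow t (nsum σ) * excWeight x σ
      ≡⟨ cong₂ _*_ (cong₂ _*_ (cong₂ _*_ (cong (pow (- 1#)) (cyc-negWord q)) (cong (pow s) (neg-negWord q)))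
                              (cong (pow t) (nsum-negWord q-inj)))
                   (trans (prodFin≡∏ {n} _) (Product.sum-cong-≗ (if-cong ∘ inEXC-negWord q-inj))) ⟩
    sgn * S * T′ * W     ≈⟨ solve 4 (λ c S T W → ((c ⊕ S) ⊕ T) ⊕ W ⊜ (S ⊕ T) ⊕ (c ⊕ W)) ≈-refl sgn S T′ W ⟩
    S * T′ * (sgn * W)   ∎
    where
    σ : Word n
    σ = negWord q
    sgn S T′ W : Carrier
    sgn = pow (- 1#) (cycles q)
    S = pow s n
    T′ = pow t ((n *ℕ (n +ℕ 1)) / 2)
    W = ∏ (choose q x (λ _ → 1#))

  scale-closedForm : (a b : Carrier) (x : Fin (suc m) → Carrier) →
                     a * b * closedForm (suc m) x (λ _ → 1#)
                     ≈ pow (- 1#) (suc m) * a * b * x (fromℕ m) * prodFin m (λ j → x (inject₁ j) - 1#)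
  scale-closedForm {m} a b x = begin
    a * b * (sgn * xL * P)
      ≈⟨ solve 5 (λ a b c u P → (a ⊕ b) ⊕ ((c ⊕ u) ⊕ P) ⊜ (((c ⊕ a) ⊕ b) ⊕ u) ⊕ P) ≈-refl a b sgn xL P ⟩
    sgn * a * b * xL * P     ≡⟨ cong (sgn * a * b * xL *_) (prodFin≡∏ {m} _) ⟨
    sgn * a * b * xL * prodFin m (λ j → x (inject₁ j) - 1#) ∎
    where
    sgn xL P : Carrier
    sgn = pow (- 1#) (suc m)
    xL = x (fromℕ m)
    P = ∏ (λ j → x (inject₁ j) - 1#)

lemma4p3 : {c ℓ : Level} (R : CommutativeRing c ℓ) (m : ℕ) →
  let open CommutativeRing R
      open RingOps R
      n = suc m
  in (x : Fin n → Carrier) (s t : Carrier) →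
     sumL (Bminus n) (λ σ → pow (- 1#) (cyc σ) * pow s (neg σ) * pow t (nsum σ) * excWeight x σ)
     ≈ pow (- 1#) n * pow s n * pow t ((n *ℕ (n +ℕ 1)) / 2) * x (fromℕ m)
       * prodFin m (λ j → x (inject₁ j) - 1#)
lemma4p3 R m x s t = begin
  sumL (Bminus (suc m)) summand                ≈⟨ sumL-↭ summand Bminus↭negWords ⟩
  sumL (negWords (suc m)) summand              ≡⟨ sumL-map negWord (perms (suc m)) summand ⟩
  sumL (perms (suc m)) (summand ∘ negWord)     ≈⟨ sumL-cong (perms (suc m)) (λ q∈ → summand-negWord (perms-injective q∈) x s t) ⟩
  sumL (perms (suc m)) (λ q → K * weight x ones q) ≈⟨ *-distribˡ-sumL (perms (suc m)) K _ ⟩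
  K * sumL (perms (suc m)) (weight x ones)     ≈⟨ *-congˡ (sumL-perms-weight (suc m) x ones) ⟩
  K * closedForm (suc m) x ones                ≈⟨ scale-closedForm _ _ x ⟩
  pow (- 1#) (suc m) * pow s (suc m) * pow t ((suc m *ℕ (suc m +ℕ 1)) / 2) * x (fromℕ m)
    * prodFin m (λ j → x (inject₁ j) - 1#)     ∎
  where
  open CommutativeRing R using (Carrier; _*_; -_; _-_; 1#; *-congˡ; setoid)
  open RingOps R
  open SignedSum R
  open SetoidReasoning setoid
  summand : Word (suc m) → Carrier
  summand σ = pow (- 1#) (cyc σ) * pow s (neg σ) * pow t (nsum σ) * excWeight x σ
  ones : Fin (suc m) → Carrier
  ones _ = 1#
  K : Carrier
  K = pow s (suc m) * pow t ((suc m *ℕ (suc m +ℕ 1)) / 2)
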